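{- Let $m,n\geq 3$ be integers. Then: (i) if $m$ and $n$ are both even, $\chi'_s(C_m\square C_n)\leq 7$; (ii) if $m>3$ is odd and $n$ is even, $\chi'_s(C_m\square C_n)\leq 8$; (iii) if $m=3$ and $n$ is even, $\chi'_s(C_m\square C_n)\leq 9$; (iv) if $m$ and $n$ are both odd, $\chi'_s(C_m\square C_n)\leq 10$.
   Context: $C_n$ is the cycle on $n$ vertices. A star edge coloring of a graph is a proper edge coloring such that no path or cycle with four edges uses at most two colors; $\chi'_s(G)$ is the minimum number of colors in a star edge coloring of $G$. The Cartesian product $G\square H$ has vertex set $V(G)\times V(H)$, with $(a,x)(b,y)$ an edge iff either $ab\in E(G)$ and $x=y$, or $xy\in E(H)$ and $a=b$. -}

module Defs where

open import Data.Nat using (ℕ; zero; suc)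
open import Data.Fin using (Fin; toℕ)
open import Data.Product using (_×_; Σ; ∃)
open import Data.Sum using (_⊎_)
open import Data.Empty renaming (⊥ to ⊥')
open import Relation.Binary.PropositionalEquality using (_≡_; _≢_)

Succ : (m : ℕ) → Fin m → Fin m → Set
Succ m i j = (suc (toℕ i) ≡ toℕ j) ⊎ ((suc (toℕ i) ≡ m) × (toℕ j ≡ 0))

CycleAdj : (m : ℕ) → Fin m → Fin m → Set
CycleAdj m i j = Succ m i j ⊎ Succ m j i

_□_ : {A B : Set} → (A → A → Set) → (B → B → Set) → (A × B → A × B → Set)
(G □ H) (a Data.Product., x) (b Data.Product., y) = (G a b × x ≡ y) ⊎ (a ≡ b × H x y)

AtMostTwo : {k : ℕ} → Fin k → Fin k → Fin k → Fin k → Set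
AtMostTwo {k} c₁ c₂ c₃ c₄ =
  Σ (Fin k) λ a → Σ (Fin k) λ b →
    (c₁ ≡ a ⊎ c₁ ≡ b) × (c₂ ≡ a ⊎ c₂ ≡ b) × (c₃ ≡ a ⊎ c₃ ≡ b) × (c₄ ≡ a ⊎ c₄ ≡ b)

-- An edge colouring with colours Fin k is given by c : V → V → Fin k, where
-- the colour of edge uv is c u v (values on non-edges are irrelevant).
record StarEdgeColoring {V : Set} (Adj : V → V → Set) (k : ℕ) (c : V → V → Fin k) : Set where
  field
    symmetric : ∀ u v → Adj u v → c u v ≡ c v u
    proper    : ∀ u v w → Adj u v → Adj u w → v ≢ w → c u v ≢ c u w
    noPath    : ∀ v₀ v₁ v₂ v₃ v₄ →
                Adj v₀ v₁ → Adj v₁ v₂ → Adj v₂ v₃ → Adj v₃ v₄ →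
                v₀ ≢ v₁ → v₀ ≢ v₂ → v₀ ≢ v₃ → v₀ ≢ v₄ →
                v₁ ≢ v₂ → v₁ ≢ v₃ → v₁ ≢ v₄ →
                v₂ ≢ v₃ → v₂ ≢ v₄ → v₃ ≢ v₄ →
                AtMostTwo (c v₀ v₁) (c v₁ v₂) (c v₂ v₃) (c v₃ v₄) → ⊥'
    noCycle   : ∀ v₀ v₁ v₂ v₃ →
                Adj v₀ v₁ → Adj v₁ v₂ → Adj v₂ v₃ → Adj v₃ v₀ →
                v₀ ≢ v₁ → v₀ ≢ v₂ → v₀ ≢ v₃ →
                v₁ ≢ v₂ → v₁ ≢ v₃ → v₂ ≢ v₃ →
                AtMostTwo (c v₀ v₁) (c v₁ v₂) (c v₂ v₃) (c v₃ v₀) → ⊥'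

StarChromaticIndex≤ : {V : Set} → (V → V → Set) → ℕ → Set
StarChromaticIndex≤ {V} Adj k = Σ (V → V → Fin k) λ c → StarEdgeColoring Adj k c

CmCn : (m n : ℕ) → Fin m × Fin n → Fin m × Fin n → Set
CmCn m n = CycleAdj m □ CycleAdj n

-- Idea: colour C_m □ C_n by pulling back a colouring of a small "pattern", a
-- finite digraph A receiving a homomorphism C_m → A from the directed cycle.
-- Given patterns A, B and colour tables F, G on A × B (F for horizontal arcs,
-- G for vertical ones), every edge of C_m □ C_n inherits the colour of the arc
-- it is mapped to.  A non-backtracking torus walk maps to a non-backtracking
-- walk of A × B with the same colours; so if in A × B steps in different
-- directions have different colours and no non-backtracking walk of four
-- steps uses at most two colours, the pulled-back colouring is a star edge
-- colouring.  This finite condition is decidable and verified by evaluation.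
-- Homomorphisms C_m → A come from closed walks of length m, which exist for
-- the relevant m because each pattern contains cycles of suitable lengths
-- through a common vertex.  The theorem instantiates this transfer lemma with
-- four certified pattern colourings using 7, 8, 9 and 10 colours.

module Submission where

open import Defs
open import Data.Nat using (ℕ; _≤_; _<_)
open import Data.Nat.Divisibility using (_∣_)
open import Data.Product using (_×_)
open import Relation.Nullary using (¬_)
open import Relation.Binary.PropositionalEquality using (_≡_)

open import Data.Bool using (if_then_else_)
open import Data.Empty using (⊥; ⊥-elim)
open import Data.Fin using (Fin; toℕ; inject₁; fromℕ) renaming (zero to fzero; suc to fsuc; _≟_ to _≟F_)
open import Data.Fin.Properties using (toℕ-injective; toℕ<n; toℕ-inject₁; toℕ-fromℕ) renaming (all? to ∀Fin?)
open import Data.List using (List; []; _∷_; map; filter; allFin)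
open import Data.List.Membership.Propositional using (_∈_)
open import Data.List.Membership.Propositional.Properties using (∈-map⁺; ∈-allFin; ∈-filter⁺)
import Data.List.Membership.DecPropositional as DecMembership
open import Data.List.Relation.Unary.All as All using (All; all?)
open import Data.List.Relation.Unary.Any using (here; there)
open import Data.Maybe using (Maybe; just; nothing)
open import Data.Nat using (zero; suc; _+_; s≤s; z≤n) renaming (_≟_ to _≟ℕ_)
open import Data.Nat.Properties using (suc-injective; <-irrefl; 1+n≢0; 1+n≢n; m≢1+n+m)
open import Data.Nat.Divisibility using (_∣?_; divides; ∣m+n∣m⇒∣n; ∣m∣n⇒∣m+n)
open import Data.Product using (Σ; _,_; proj₁; proj₂)
open import Data.Sum using (_⊎_; inj₁; inj₂)
open import Data.Vec using (Vec; []; _∷_; lookup)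
open import Relation.Nullary using (Dec; yes; no; does; ¬?)
open import Relation.Nullary.Decidable using (dec-true; dec-false; from-yes; from-no; _×-dec_; _⊎-dec_)
open import Relation.Binary.PropositionalEquality using (refl; sym; trans; cong; cong₂; subst; _≢_; module ≡-Reasoning)
open ≡-Reasoning

-- Four colours cannot lie within two values as soon as three of them are
-- pairwise distinct; this decidable criterion replaces 'AtMostTwo' in the
-- finite verification below.

ThreeDistinct : {k : ℕ} → Fin k → Fin k → Fin k → Set
ThreeDistinct x y z = x ≢ y × x ≢ z × y ≢ z

SomeThreeDistinct : {k : ℕ} → Vec (Fin k) 4 → Set
SomeThreeDistinct (c₁ ∷ c₂ ∷ c₃ ∷ c₄ ∷ []) =
  ThreeDistinct c₁ c₂ c₃ ⊎ ThreeDistinct c₁ c₂ c₄ ⊎ ThreeDistinct c₁ c₃ c₄ ⊎ ThreeDistinct c₂ c₃ c₄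

someThreeDistinct? : {k : ℕ} (cs : Vec (Fin k) 4) → Dec (SomeThreeDistinct cs)
someThreeDistinct? (c₁ ∷ c₂ ∷ c₃ ∷ c₄ ∷ []) =
  distinct? c₁ c₂ c₃ ⊎-dec distinct? c₁ c₂ c₄ ⊎-dec distinct? c₁ c₃ c₄ ⊎-dec distinct? c₂ c₃ c₄
  where
  distinct? : ∀ x y z → Dec (ThreeDistinct x y z)
  distinct? x y z = ¬? (x ≟F y) ×-dec ¬? (x ≟F z) ×-dec ¬? (y ≟F z)

threeDistinct-not-in-pair : {k : ℕ} {x y z a b : Fin k} → ThreeDistinct x y z →
  (x ≡ a ⊎ x ≡ b) → (y ≡ a ⊎ y ≡ b) → (z ≡ a ⊎ z ≡ b) → ⊥
threeDistinct-not-in-pair (x≢y , x≢z , y≢z) = pigeonhole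
  where
  pigeonhole : _ → _ → _ → ⊥
  pigeonhole (inj₁ x≡a) (inj₁ y≡a) _         = x≢y (trans x≡a (sym y≡a))
  pigeonhole (inj₂ x≡b) (inj₂ y≡b) _         = x≢y (trans x≡b (sym y≡b))
  pigeonhole (inj₁ x≡a) (inj₂ _)   (inj₁ z≡a) = x≢z (trans x≡a (sym z≡a))
  pigeonhole (inj₂ x≡b) (inj₁ _)   (inj₂ z≡b) = x≢z (trans x≡b (sym z≡b))
  pigeonhole (inj₁ _)   (inj₂ y≡b) (inj₂ z≡b) = y≢z (trans y≡b (sym z≡b))
  pigeonhole (inj₂ _)   (inj₁ y≡a) (inj₁ z≡a) = y≢z (trans y≡a (sym z≡a))

someThreeDistinct⇒¬atMostTwo : {k : ℕ} {c₁ c₂ c₃ c₄ : Fin k} →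
  SomeThreeDistinct (c₁ ∷ c₂ ∷ c₃ ∷ c₄ ∷ []) → ¬ AtMostTwo c₁ c₂ c₃ c₄
someThreeDistinct⇒¬atMostTwo (inj₁ t)               (_ , _ , e₁ , e₂ , e₃ , e₄) = threeDistinct-not-in-pair t e₁ e₂ e₃
someThreeDistinct⇒¬atMostTwo (inj₂ (inj₁ t))        (_ , _ , e₁ , e₂ , e₃ , e₄) = threeDistinct-not-in-pair t e₁ e₂ e₄
someThreeDistinct⇒¬atMostTwo (inj₂ (inj₂ (inj₁ t))) (_ , _ , e₁ , e₂ , e₃ , e₄) = threeDistinct-not-in-pair t e₁ e₃ e₄
someThreeDistinct⇒¬atMostTwo (inj₂ (inj₂ (inj₂ t))) (_ , _ , e₁ , e₂ , e₃ , e₄) = threeDistinct-not-in-pair t e₂ e₃ e₄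

succ? : (m : ℕ) (i j : Fin m) → Dec (Succ m i j)
succ? m i j = (suc (toℕ i) ≟ℕ toℕ j) ⊎-dec ((suc (toℕ i) ≟ℕ m) ×-dec (toℕ j ≟ℕ 0))

module CycleFacts {m : ℕ} (m≥3 : 3 ≤ m) where

  m≢1 : m ≢ 1
  m≢1 m≡1 with subst (3 ≤_) m≡1 m≥3
  ... | s≤s ()

  m≢2 : m ≢ 2
  m≢2 m≡2 with subst (3 ≤_) m≡2 m≥3
  ... | s≤s (s≤s ())

  toℕ≢m : (j : Fin m) → toℕ j ≢ m
  toℕ≢m j j≡m = <-irrefl j≡m (toℕ<n j)

  succ-functional : ∀ {i j j'} → Succ m i j → Succ m i j' → j ≡ j'
  succ-functional     (inj₁ p)       (inj₁ q)       = toℕ-injective (trans (sym p) q)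
  succ-functional {j = j}   (inj₁ p) (inj₂ (q , _)) = ⊥-elim (toℕ≢m j (trans (sym p) q))
  succ-functional {j' = j'} (inj₂ (q , _)) (inj₁ p) = ⊥-elim (toℕ≢m j' (trans (sym p) q))
  succ-functional     (inj₂ (_ , p)) (inj₂ (_ , q)) = toℕ-injective (trans p (sym q))

  succ-injective : ∀ {i i' j} → Succ m i j → Succ m i' j → i ≡ i'
  succ-injective (inj₁ p)       (inj₁ q)       = toℕ-injective (suc-injective (trans p (sym q)))
  succ-injective (inj₁ p)       (inj₂ (_ , q)) = ⊥-elim (1+n≢0 (trans p q))
  succ-injective (inj₂ (_ , q)) (inj₁ p)       = ⊥-elim (1+n≢0 (trans p q))
  succ-injective (inj₂ (p , _)) (inj₂ (q , _)) = toℕ-injective (suc-injective (trans p (sym q)))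

  succ-irreflexive : ∀ {i} → ¬ Succ m i i
  succ-irreflexive (inj₁ p)       = 1+n≢n p
  succ-irreflexive (inj₂ (p , q)) = m≢1 (trans (sym p) (cong suc q))

  succ-asymmetric : ∀ {i j} → Succ m i j → ¬ Succ m j i
  succ-asymmetric {i} (inj₁ p) (inj₁ q) = m≢1+n+m (toℕ i) (sym (trans (cong suc p) q))
  succ-asymmetric (inj₁ p)       (inj₂ (q , r)) = m≢2 (trans (sym q) (cong suc (trans (sym p) (cong suc r))))
  succ-asymmetric (inj₂ (q , r)) (inj₁ p)       = m≢2 (trans (sym q) (cong suc (trans (sym p) (cong suc r))))
  succ-asymmetric (inj₂ (q , r)) (inj₂ (q' , _)) = m≢1 (trans (sym q') (cong suc r))

record Pattern : Set where
  field
    size : ℕ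
    out  : Fin size → List (Fin size)

  Vertex : Set
  Vertex = Fin size

  Arc : Vertex → Vertex → Set
  Arc s t = t ∈ out s

  open DecMembership (_≟F_ {size}) using (_∈?_)

  inn : Vertex → List Vertex
  inn t = filter (λ s → t ∈? out s) (allFin size)

  arc⇒inn : ∀ {s t} → Arc s t → s ∈ inn t
  arc⇒inn {s} {t} s→t = ∈-filter⁺ (λ u → t ∈? out u) (∈-allFin s) s→t

open Pattern using (Vertex; Arc; arc⇒inn)

CycleHom : ℕ → Pattern → Set
CycleHom m P = Σ (Fin m → Vertex P) λ h → ∀ i j → Succ m i j → Arc P (h i) (h j)

data Walk (P : Pattern) : Vertex P → Vertex P → ℕ → Set where
  []  : ∀ {s} → Walk P s s 0
  _∷_ : ∀ {s t u n} → Arc P s t → Walk P t u n → Walk P s u (suc n)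

infixr 5 _∷_ _++_

_++_ : ∀ {P s t u m n} → Walk P s t m → Walk P t u n → Walk P s u (m + n)
[]      ++ w' = w'
(a ∷ w) ++ w' = a ∷ (w ++ w')

vertexAt : ∀ {P s t n} → Walk P s t n → Fin (suc n) → Vertex P
vertexAt {s = s} _  fzero    = s
vertexAt (_ ∷ w)    (fsuc i) = vertexAt w i

vertexAt-arc : ∀ {P s t n} (w : Walk P s t n) (i : Fin n) →
               Arc P (vertexAt w (inject₁ i)) (vertexAt w (fsuc i))
vertexAt-arc (a ∷ _) fzero    = a
vertexAt-arc (_ ∷ w) (fsuc i) = vertexAt-arc w i

vertexAt-last : ∀ {P s t n} (w : Walk P s t n) → vertexAt w (fromℕ n) ≡ t
vertexAt-last []      = refl
vertexAt-last (_ ∷ w) = vertexAt-last w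

closedWalk⇒hom : ∀ {P s m} → Walk P s s m → CycleHom m P
closedWalk⇒hom {P} {s} {m} w = (λ i → vertexAt w (inject₁ i)) , arc
  where
  arc : ∀ i j → Succ m i j → Arc P (vertexAt w (inject₁ i)) (vertexAt w (inject₁ j))
  arc i j (inj₁ i+1≡j) = subst (λ x → Arc P _ (vertexAt w x)) next≡j (vertexAt-arc w i)
    where
    next≡j : fsuc i ≡ inject₁ j
    next≡j = toℕ-injective (trans i+1≡j (sym (toℕ-inject₁ j)))
  arc i j (inj₂ (i+1≡m , j≡0)) = subst (Arc P _) wraps (vertexAt-arc w i)
    where
    wraps : vertexAt w (fsuc i) ≡ vertexAt w (inject₁ j)
    wraps = begin
      vertexAt w (fsuc i)      ≡⟨ cong (vertexAt w) (toℕ-injective (trans i+1≡m (sym (toℕ-fromℕ m)))) ⟩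
      vertexAt w (fromℕ m)     ≡⟨ vertexAt-last w ⟩
      s                        ≡⟨ cong (vertexAt w) (toℕ-injective (sym (trans (toℕ-inject₁ j) j≡0))) ⟩
      vertexAt w (inject₁ j)   ∎

data Dir : Set where
  right left up down : Dir

reverse : Dir → Dir
reverse right = left
reverse left  = right
reverse up    = down
reverse down  = up

dirs : List Dir
dirs = right ∷ left ∷ up ∷ down ∷ []

dir∈dirs : ∀ d → d ∈ dirs
dir∈dirs right = here refl
dir∈dirs left  = there (here refl)
dir∈dirs up    = there (there (here refl))
dir∈dirs down  = there (there (there (here refl)))

_≟D_ : (d d' : Dir) → Dec (d ≡ d')
right ≟D right = yes refl
left  ≟D left  = yes refl
up    ≟D up    = yes refl
down  ≟D down  = yes refl
right ≟D left  = no λ ()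
right ≟D up    = no λ ()
right ≟D down  = no λ ()
left  ≟D right = no λ ()
left  ≟D up    = no λ ()
left  ≟D down  = no λ ()
up    ≟D right = no λ ()
up    ≟D left  = no λ ()
up    ≟D down  = no λ ()
down  ≟D right = no λ ()
down  ≟D left  = no λ ()
down  ≟D up    = no λ ()

Backtracks : Maybe Dir → Dir → Set
Backtracks nothing   _ = ⊥
Backtracks (just d₀) d = d ≡ reverse d₀

backtracks? : ∀ prev d → Dec (Backtracks prev d)
backtracks? nothing   _ = no λ ()
backtracks? (just d₀) d = d ≟D reverse d₀

-- A colouring of the product of patterns A and B: F colours the horizontal
-- arc leaving (x , y) along A, G the vertical arc leaving (x , y) along B.
-- 'Valid' is the finite condition making the induced torus colouring a star
-- edge colouring; it is decidable, hence checkable by evaluation.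
module ProductPattern {k : ℕ} (A B : Pattern) (F G : Vertex A → Vertex B → Fin k) where

  State : Set
  State = Vertex A × Vertex B

  steps : Dir → State → List (State × Fin k)
  steps right (x , y) = map (λ x' → (x' , y) , F x y)  (Pattern.out A x)
  steps left  (x , y) = map (λ x' → (x' , y) , F x' y) (Pattern.inn A x)
  steps up    (x , y) = map (λ y' → (x , y') , G x y)  (Pattern.out B y)
  steps down  (x , y) = map (λ y' → (x , y') , G x y') (Pattern.inn B y)

  Proper : Set
  Proper = ∀ x y → All (λ d → All (λ d' → d ≡ d' ⊎
             All (λ p → All (λ p' → proj₂ p ≢ proj₂ p') (steps d' (x , y))) (steps d (x , y))) dirs) dirs

  proper? : Dec Proper
  proper? = ∀Fin? λ x → ∀Fin? λ y → all? (λ d → all? (λ d' → (d ≟D d') ⊎-dec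
             all? (λ p → all? (λ p' → ¬? (proj₂ p ≟F proj₂ p')) (steps d' (x , y))) (steps d (x , y))) dirs) dirs

  Walks : (n : ℕ) → Maybe Dir → State → (Vec (Fin k) n → Set) → Set
  Walks zero    _    _ Q = Q []
  Walks (suc n) prev s Q = All (λ d → Backtracks prev d ⊎
    All (λ p → Walks n (just d) (proj₁ p) (λ cs → Q (proj₂ p ∷ cs))) (steps d s)) dirs

  walks? : ∀ n prev s {Q} → (∀ cs → Dec (Q cs)) → Dec (Walks n prev s Q)
  walks? zero    _    _ Q? = Q? []
  walks? (suc n) prev s Q? = all? (λ d → backtracks? prev d ⊎-dec
    all? (λ p → walks? n (just d) (proj₁ p) (λ cs → Q? (proj₂ p ∷ cs))) (steps d s)) dirs

  StarFree : Set
  StarFree = ∀ x y → Walks 4 nothing (x , y) SomeThreeDistinct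

  Valid : Set
  Valid = Proper × StarFree

  valid? : Dec Valid
  valid? = proper? ×-dec ∀Fin? (λ x → ∀Fin? λ y → walks? 4 nothing (x , y) someThreeDistinct?)

  module Torus {m n : ℕ} (m≥3 : 3 ≤ m) (n≥3 : 3 ≤ n)
               (homA : CycleHom m A) (homB : CycleHom n B) where
    module Cm = CycleFacts m≥3
    module Cn = CycleFacts n≥3

    α : Fin m → Vertex A
    α = proj₁ homA

    β : Fin n → Vertex B
    β = proj₁ homB

    V : Set
    V = Fin m × Fin n

    π : V → State
    π v = α (proj₁ v) , β (proj₂ v)

    Step : Dir → V → V → Set
    Step right (i , j) (i' , j') = Succ m i i' × j ≡ j'
    Step left  (i , j) (i' , j') = Succ m i' i × j ≡ j'
    Step up    (i , j) (i' , j') = i ≡ i' × Succ n j j'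
    Step down  (i , j) (i' , j') = i ≡ i' × Succ n j' j

    adj⇒step : ∀ u v → CmCn m n u v → Σ Dir λ d → Step d u v
    adj⇒step _ _ (inj₁ (inj₁ s , e)) = right , s , e
    adj⇒step _ _ (inj₁ (inj₂ s , e)) = left  , s , e
    adj⇒step _ _ (inj₂ (e , inj₁ s)) = up    , e , s
    adj⇒step _ _ (inj₂ (e , inj₂ s)) = down  , e , s

    step-reverse : ∀ d {u v w} → Step d u v → Step (reverse d) v w → u ≡ w
    step-reverse right (s , e) (s' , e') = cong₂ _,_ (Cm.succ-injective s s') (trans e e')
    step-reverse left  (s , e) (s' , e') = cong₂ _,_ (Cm.succ-functional s s') (trans e e')
    step-reverse up    (e , s) (e' , s') = cong₂ _,_ (trans e e') (Cn.succ-injective s s')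
    step-reverse down  (e , s) (e' , s') = cong₂ _,_ (trans e e') (Cn.succ-functional s s')

    step-functional : ∀ d {u v w} → Step d u v → Step d u w → v ≡ w
    step-functional right (s , e) (s' , e') = cong₂ _,_ (Cm.succ-functional s s') (trans (sym e) e')
    step-functional left  (s , e) (s' , e') = cong₂ _,_ (Cm.succ-injective s s') (trans (sym e) e')
    step-functional up    (e , s) (e' , s') = cong₂ _,_ (trans (sym e) e') (Cn.succ-functional s s')
    step-functional down  (e , s) (e' , s') = cong₂ _,_ (trans (sym e) e') (Cn.succ-injective s s')

    -- The torus colouring: a horizontal edge from (i , j) to its successor
    -- (i + 1 , j) gets F (α i) (β j), a vertical one to (i , j + 1) gets G (α i) (β j).
    colour : V → V → Fin k
    colour (i , j) (i' , j') =
      if does (j ≟F j')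
      then (if does (succ? m i i') then F (α i) (β j) else F (α i') (β j))
      else (if does (succ? n j j') then G (α i) (β j) else G (α i) (β j'))

    colour-right : ∀ {i i' j} → Succ m i i' → colour (i , j) (i' , j) ≡ F (α i) (β j)
    colour-right {i} {i'} {j} s
      rewrite dec-true (j ≟F j) refl | dec-true (succ? m i i') s = refl

    colour-left : ∀ {i i' j} → Succ m i' i → colour (i , j) (i' , j) ≡ F (α i') (β j)
    colour-left {i} {i'} {j} s
      rewrite dec-true (j ≟F j) refl | dec-false (succ? m i i') (Cm.succ-asymmetric s) = refl

    colour-up : ∀ {i j j'} → Succ n j j' → colour (i , j) (i , j') ≡ G (α i) (β j)
    colour-up {i} {j} {j'} s
      rewrite dec-false (j ≟F j') (λ { refl → Cn.succ-irreflexive s })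
            | dec-true (succ? n j j') s = refl

    colour-down : ∀ {i j j'} → Succ n j' j → colour (i , j) (i , j') ≡ G (α i) (β j')
    colour-down {i} {j} {j'} s
      rewrite dec-false (j ≟F j') (λ { refl → Cn.succ-irreflexive s })
            | dec-false (succ? n j j') (Cn.succ-asymmetric s) = refl

    lift-step : ∀ d {u v} → Step d u v → (π v , colour u v) ∈ steps d (π u)
    lift-step right {i , j} {i' , _} (s , refl) rewrite colour-right {i} {i'} {j} s =
      ∈-map⁺ (λ x' → (x' , β j) , F (α i) (β j)) (proj₂ homA i i' s)
    lift-step left {i , j} {i' , _} (s , refl) rewrite colour-left {i} {i'} {j} s =
      ∈-map⁺ (λ x' → (x' , β j) , F x' (β j)) (arc⇒inn A (proj₂ homA i' i s))
    lift-step up {i , j} {_ , j'} (refl , s) rewrite colour-up {i} {j} {j'} s =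
      ∈-map⁺ (λ y' → (α i , y') , G (α i) (β j)) (proj₂ homB j j' s)
    lift-step down {i , j} {_ , j'} (refl , s) rewrite colour-down {i} {j} {j'} s =
      ∈-map⁺ (λ y' → (α i , y') , G (α i) y') (arc⇒inn B (proj₂ homB j' j s))

    colour-symmetric : ∀ u v → CmCn m n u v → colour u v ≡ colour v u
    colour-symmetric (i , j) (i' , j') a with adj⇒step (i , j) (i' , j') a
    ... | right , s , refl = trans (colour-right {i} {i'} {j} s) (sym (colour-left {i'} {i} {j} s))
    ... | left  , s , refl = trans (colour-left {i} {i'} {j} s) (sym (colour-right {i'} {i} {j} s))
    ... | up    , refl , s = trans (colour-up {i} {j} {j'} s) (sym (colour-down {i} {j'} {j} s))
    ... | down  , refl , s = trans (colour-down {i} {j} {j'} s) (sym (colour-up {i} {j'} {j} s))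

    colour-proper : Proper → ∀ u v w → CmCn m n u v → CmCn m n u w → v ≢ w → colour u v ≢ colour u w
    colour-proper proper u v w uv uw v≢w with adj⇒step u v uv | adj⇒step u w uw
    ... | d , s | d' , s' with All.lookup (All.lookup (proper (α (proj₁ u)) (β (proj₂ u))) (dir∈dirs d)) (dir∈dirs d')
    ... | inj₁ refl    = λ _ → v≢w (step-functional d s s')
    ... | inj₂ differ = All.lookup (All.lookup differ (lift-step d s)) (lift-step d' s')

    walks-step : ∀ {ℓ prev d u v Q} → Walks (suc ℓ) prev (π u) Q → Step d u v →
                 ¬ Backtracks prev d → Walks ℓ (just d) (π v) (λ cs → Q (colour u v ∷ cs))
    walks-step {d = d} W s no-back with All.lookup W (dir∈dirs d)
    ... | inj₁ back  = ⊥-elim (no-back back)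
    ... | inj₂ onward = All.lookup onward (lift-step d s)

    no-backtrack : ∀ {d₀ d t u v} → Step d₀ t u → Step d u v → t ≢ v → ¬ Backtracks (just d₀) d
    no-backtrack {d₀} s₀ s t≢v refl = t≢v (step-reverse d₀ s₀ s)

    fourWalk : StarFree → ∀ {d₁ d₂ d₃ d₄ v₀ v₁ v₂ v₃ v₄} →
      Step d₁ v₀ v₁ → Step d₂ v₁ v₂ → Step d₃ v₂ v₃ → Step d₄ v₃ v₄ →
      v₀ ≢ v₂ → v₁ ≢ v₃ → v₂ ≢ v₄ →
      SomeThreeDistinct (colour v₀ v₁ ∷ colour v₁ v₂ ∷ colour v₂ v₃ ∷ colour v₃ v₄ ∷ [])
    fourWalk starFree {d₁} {d₂} {d₃} {v₀ = v₀} {v₁} {v₂} {v₃} s₁ s₂ s₃ s₄ v₀≢v₂ v₁≢v₃ v₂≢v₄ =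
      walks-step {Q = λ cs → SomeThreeDistinct (c₁ ∷ c₂ ∷ c₃ ∷ cs)} after₃ s₄ (no-backtrack s₃ s₄ v₂≢v₄)
      where
      c₁ c₂ c₃ : Fin k
      c₁ = colour v₀ v₁
      c₂ = colour v₁ v₂
      c₃ = colour v₂ v₃
      after₁ : Walks 3 (just d₁) (π v₁) (λ cs → SomeThreeDistinct (c₁ ∷ cs))
      after₁ = walks-step {Q = SomeThreeDistinct} (starFree (α (proj₁ v₀)) (β (proj₂ v₀))) s₁ λ ()
      after₂ : Walks 2 (just d₂) (π v₂) (λ cs → SomeThreeDistinct (c₁ ∷ c₂ ∷ cs))
      after₂ = walks-step {Q = λ cs → SomeThreeDistinct (c₁ ∷ cs)} after₁ s₂ (no-backtrack s₁ s₂ v₀≢v₂)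
      after₃ : Walks 1 (just d₃) (π v₃) (λ cs → SomeThreeDistinct (c₁ ∷ c₂ ∷ c₃ ∷ cs))
      after₃ = walks-step {Q = λ cs → SomeThreeDistinct (c₁ ∷ c₂ ∷ cs)} after₂ s₃ (no-backtrack s₂ s₃ v₁≢v₃)

    -- The 'noPath'/'noCycle' condition: four steps with v₀ ≠ v₂, v₁ ≠ v₃, v₂ ≠ v₄.
    noBicolouredWalk : StarFree → ∀ v₀ v₁ v₂ v₃ v₄ →
      CmCn m n v₀ v₁ → CmCn m n v₁ v₂ → CmCn m n v₂ v₃ → CmCn m n v₃ v₄ →
      v₀ ≢ v₂ → v₁ ≢ v₃ → v₂ ≢ v₄ →
      ¬ AtMostTwo (colour v₀ v₁) (colour v₁ v₂) (colour v₂ v₃) (colour v₃ v₄)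
    noBicolouredWalk starFree v₀ v₁ v₂ v₃ v₄ a₁ a₂ a₃ a₄ v₀≢v₂ v₁≢v₃ v₂≢v₄ =
      someThreeDistinct⇒¬atMostTwo
        (fourWalk starFree (proj₂ (adj⇒step v₀ v₁ a₁)) (proj₂ (adj⇒step v₁ v₂ a₂))
                           (proj₂ (adj⇒step v₂ v₃ a₃)) (proj₂ (adj⇒step v₃ v₄ a₄)) v₀≢v₂ v₁≢v₃ v₂≢v₄)

    starEdgeColouring : Valid → StarEdgeColoring (CmCn m n) k colour
    starEdgeColouring (proper , starFree) = record
      { symmetric = colour-symmetric
      ; proper    = colour-proper proper
      ; noPath    = λ v₀ v₁ v₂ v₃ v₄ a₁ a₂ a₃ a₄ _ v₀≢v₂ _ _ _ v₁≢v₃ _ _ v₂≢v₄ _ →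
                      noBicolouredWalk starFree v₀ v₁ v₂ v₃ v₄ a₁ a₂ a₃ a₄ v₀≢v₂ v₁≢v₃ v₂≢v₄
      ; noCycle   = λ v₀ v₁ v₂ v₃ a₁ a₂ a₃ a₄ _ v₀≢v₂ _ _ v₁≢v₃ _ →
                      noBicolouredWalk starFree v₀ v₁ v₂ v₃ v₀ a₁ a₂ a₃ a₄ v₀≢v₂ v₁≢v₃ (λ v₂≡v₀ → v₀≢v₂ (sym v₂≡v₀))
      }

record ValidPatternColouring (k : ℕ) : Set where
  field
    A B   : Pattern
    F G   : Vertex A → Vertex B → Fin k
    valid : ProductPattern.Valid A B F G

transfer : ∀ {k m n} (P : ValidPatternColouring k) → 3 ≤ m → 3 ≤ n →
           CycleHom m (ValidPatternColouring.A P) → CycleHom n (ValidPatternColouring.B P) →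
           StarChromaticIndex≤ (CmCn m n) k
transfer P m≥3 n≥3 homA homB = colour , starEdgeColouring valid
  where
  open ValidPatternColouring P
  open ProductPattern.Torus A B F G m≥3 n≥3 homA homB

2∣4+n⇒2∣n : ∀ {n} → 2 ∣ 4 + n → 2 ∣ n
2∣4+n⇒2∣n 2∣4+n = ∣m+n∣m⇒∣n 2∣4+n (divides 2 refl)

2∣n⇒2∣4+n : ∀ {n} → 2 ∣ n → 2 ∣ 4 + n
2∣n⇒2∣4+n = ∣m∣n⇒∣m+n (divides 2 refl)

module Constructions where
  open import Agda.Builtin.FromNat using (Number; fromNat)
  import Data.Fin.Literals as FinLiterals
  import Data.Nat.Literals as NatLiterals
  open import Data.Unit using (⊤; tt)

  instance
    finLiterals : ∀ {n} → Number (Fin n)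
    finLiterals {n} = FinLiterals.number n
    natLiterals : Number ℕ
    natLiterals = NatLiterals.number
    -- Side condition of ℕ numerals.
    trivialConstraint : ⊤
    trivialConstraint = tt

  -- Three patterns, each a bouquet of cycles through vertex 0:
  --   evenPattern : a 4-cycle and a 6-cycle sharing the arc 0 → 1;
  --   oddPattern  : a 4-, a 5- and a 7-cycle sharing the path 0 → 1 → 2 → 3;
  --   anyPattern  : a 3-, a 4- and a 5-cycle sharing the path 0 → 1 → 2.
  evenPattern : Pattern
  evenPattern = record { size = 8 ; out = lookup outLists }
    where
    outLists : Vec (List (Fin 8)) 8
    outLists = (1 ∷ []) ∷ (2 ∷ 4 ∷ []) ∷ (3 ∷ []) ∷ (0 ∷ []) ∷ (5 ∷ []) ∷ (6 ∷ []) ∷ (7 ∷ []) ∷ (0 ∷ []) ∷ []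

  oddPattern : Pattern
  oddPattern = record { size = 8 ; out = lookup outLists }
    where
    outLists : Vec (List (Fin 8)) 8
    outLists = (1 ∷ []) ∷ (2 ∷ []) ∷ (3 ∷ []) ∷ (0 ∷ 4 ∷ 5 ∷ []) ∷ (0 ∷ []) ∷ (6 ∷ []) ∷ (7 ∷ []) ∷ (0 ∷ []) ∷ []

  anyPattern : Pattern
  anyPattern = record { size = 5 ; out = lookup outLists }
    where
    outLists : Vec (List (Fin 5)) 5
    outLists = (1 ∷ []) ∷ (2 ∷ []) ∷ (0 ∷ 3 ∷ []) ∷ (0 ∷ 4 ∷ []) ∷ (0 ∷ []) ∷ []

  -- Closed walks of every admissible length: every even m ≥ 4 is 4q + 4 or
  -- 4q + 6, every odd m ≥ 5 is 4q + 5 or 4q + 7, and every m ≥ 3 is 3q + 3,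
  -- 3q + 4 or 3q + 5; longer walks prepend a traversal of the shortest cycle.
  evenWalk : ∀ m → 3 ≤ m → 2 ∣ m → Walk evenPattern 0 0 m
  evenWalk 1 (s≤s ()) _
  evenWalk 2 (s≤s (s≤s ())) _
  evenWalk 3 _ 2∣3 = ⊥-elim (from-no (2 ∣? 3) 2∣3)
  evenWalk 4 _ _   = here refl ∷ here refl ∷ here refl ∷ here refl ∷ []
  evenWalk 5 _ 2∣5 = ⊥-elim (from-no (2 ∣? 5) 2∣5)
  evenWalk 6 _ _   = here refl ∷ there (here refl) ∷ here refl ∷ here refl ∷ here refl ∷ here refl ∷ []
  evenWalk 7 _ 2∣7 = ⊥-elim (from-no (2 ∣? 7) 2∣7)
  evenWalk (suc (suc (suc (suc m@(suc (suc (suc (suc _)))))))) _ 2∣4+m =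
    evenWalk 4 (s≤s (s≤s (s≤s z≤n))) (divides 2 refl) ++ evenWalk m (s≤s (s≤s (s≤s z≤n))) (2∣4+n⇒2∣n 2∣4+m)

  oddWalk : ∀ m → 3 < m → ¬ 2 ∣ m → Walk oddPattern 0 0 m
  oddWalk 1 (s≤s ()) _
  oddWalk 2 (s≤s (s≤s ())) _
  oddWalk 3 (s≤s (s≤s (s≤s ()))) _
  oddWalk 4 _ 2∤4 = ⊥-elim (2∤4 (divides 2 refl))
  oddWalk 5 _ _   = here refl ∷ here refl ∷ here refl ∷ there (here refl) ∷ here refl ∷ []
  oddWalk 6 _ 2∤6 = ⊥-elim (2∤6 (divides 3 refl))
  oddWalk 7 _ _   = here refl ∷ here refl ∷ here refl ∷ there (there (here refl)) ∷ here refl ∷ here refl ∷ here refl ∷ []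
  oddWalk 8 _ 2∤8 = ⊥-elim (2∤8 (divides 4 refl))
  oddWalk (suc (suc (suc (suc m@(suc (suc (suc (suc (suc _))))))))) _ 2∤4+m =
    square ++ oddWalk m (s≤s (s≤s (s≤s (s≤s z≤n)))) (λ 2∣m → 2∤4+m (2∣n⇒2∣4+n 2∣m))
    where
    square : Walk oddPattern 0 0 4
    square = here refl ∷ here refl ∷ here refl ∷ here refl ∷ []

  anyWalk : ∀ m → 3 ≤ m → Walk anyPattern 0 0 m
  anyWalk 1 (s≤s ())
  anyWalk 2 (s≤s (s≤s ()))
  anyWalk 3 _ = here refl ∷ here refl ∷ here refl ∷ []
  anyWalk 4 _ = here refl ∷ here refl ∷ there (here refl) ∷ here refl ∷ []
  anyWalk 5 _ = here refl ∷ here refl ∷ there (here refl) ∷ there (here refl) ∷ here refl ∷ []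
  anyWalk (suc (suc (suc m@(suc (suc (suc _)))))) _ = anyWalk 3 (s≤s (s≤s (s≤s z≤n))) ++ anyWalk m (s≤s (s≤s (s≤s z≤n)))

  evenHom : ∀ {m} → 3 ≤ m → 2 ∣ m → CycleHom m evenPattern
  evenHom {m} m≥3 2∣m = closedWalk⇒hom (evenWalk m m≥3 2∣m)

  oddHom : ∀ {m} → 3 < m → ¬ 2 ∣ m → CycleHom m oddPattern
  oddHom {m} m>3 2∤m = closedWalk⇒hom (oddWalk m m>3 2∤m)

  anyHom : ∀ {m} → 3 ≤ m → CycleHom m anyPattern
  anyHom {m} m≥3 = closedWalk⇒hom (anyWalk m m≥3)

  fromTable : ∀ {a b k} → Vec (Vec (Fin k) b) a → Fin a → Fin b → Fin k
  fromTable t x y = lookup (lookup t x) y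

  horizontal₁ vertical₁ : Vec (Vec (Fin 7) 8) 8
  horizontal₁ =
      (0 ∷ 0 ∷ 0 ∷ 0 ∷ 1 ∷ 3 ∷ 3 ∷ 1 ∷ [])
    ∷ (1 ∷ 1 ∷ 1 ∷ 1 ∷ 0 ∷ 6 ∷ 1 ∷ 0 ∷ [])
    ∷ (6 ∷ 6 ∷ 6 ∷ 0 ∷ 1 ∷ 5 ∷ 5 ∷ 1 ∷ [])
    ∷ (1 ∷ 1 ∷ 1 ∷ 6 ∷ 6 ∷ 1 ∷ 6 ∷ 6 ∷ [])
    ∷ (5 ∷ 5 ∷ 5 ∷ 0 ∷ 1 ∷ 5 ∷ 5 ∷ 1 ∷ [])
    ∷ (0 ∷ 1 ∷ 1 ∷ 5 ∷ 5 ∷ 1 ∷ 6 ∷ 5 ∷ [])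
    ∷ (6 ∷ 6 ∷ 6 ∷ 0 ∷ 1 ∷ 6 ∷ 1 ∷ 0 ∷ [])
    ∷ (1 ∷ 1 ∷ 1 ∷ 6 ∷ 6 ∷ 1 ∷ 6 ∷ 6 ∷ [])
    ∷ []
  vertical₁ =
      (4 ∷ 5 ∷ 2 ∷ 5 ∷ 2 ∷ 0 ∷ 2 ∷ 5 ∷ [])
    ∷ (2 ∷ 3 ∷ 4 ∷ 3 ∷ 4 ∷ 5 ∷ 4 ∷ 3 ∷ [])
    ∷ (4 ∷ 5 ∷ 2 ∷ 5 ∷ 2 ∷ 3 ∷ 2 ∷ 5 ∷ [])
    ∷ (2 ∷ 3 ∷ 4 ∷ 3 ∷ 4 ∷ 0 ∷ 4 ∷ 3 ∷ [])
    ∷ (4 ∷ 6 ∷ 2 ∷ 6 ∷ 2 ∷ 3 ∷ 2 ∷ 6 ∷ [])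
    ∷ (2 ∷ 3 ∷ 4 ∷ 3 ∷ 4 ∷ 0 ∷ 4 ∷ 3 ∷ [])
    ∷ (4 ∷ 0 ∷ 2 ∷ 1 ∷ 2 ∷ 3 ∷ 2 ∷ 1 ∷ [])
    ∷ (2 ∷ 3 ∷ 4 ∷ 3 ∷ 4 ∷ 5 ∷ 4 ∷ 3 ∷ [])
    ∷ []

  horizontal₂ vertical₂ : Vec (Vec (Fin 8) 8) 8
  horizontal₂ =
      (0 ∷ 0 ∷ 0 ∷ 0 ∷ 0 ∷ 0 ∷ 2 ∷ 0 ∷ [])
    ∷ (1 ∷ 1 ∷ 1 ∷ 1 ∷ 1 ∷ 5 ∷ 3 ∷ 1 ∷ [])
    ∷ (7 ∷ 6 ∷ 7 ∷ 6 ∷ 6 ∷ 3 ∷ 1 ∷ 6 ∷ [])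
    ∷ (1 ∷ 1 ∷ 1 ∷ 1 ∷ 1 ∷ 6 ∷ 0 ∷ 1 ∷ [])
    ∷ (6 ∷ 7 ∷ 6 ∷ 7 ∷ 2 ∷ 1 ∷ 4 ∷ 2 ∷ [])
    ∷ (5 ∷ 5 ∷ 5 ∷ 5 ∷ 5 ∷ 3 ∷ 6 ∷ 5 ∷ [])
    ∷ (2 ∷ 2 ∷ 4 ∷ 4 ∷ 4 ∷ 2 ∷ 2 ∷ 4 ∷ [])
    ∷ (1 ∷ 1 ∷ 1 ∷ 1 ∷ 1 ∷ 1 ∷ 0 ∷ 1 ∷ [])
    ∷ []
  vertical₂ =
      (4 ∷ 5 ∷ 2 ∷ 5 ∷ 7 ∷ 3 ∷ 7 ∷ 5 ∷ [])
    ∷ (2 ∷ 3 ∷ 4 ∷ 3 ∷ 4 ∷ 6 ∷ 4 ∷ 3 ∷ [])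
    ∷ (4 ∷ 5 ∷ 2 ∷ 5 ∷ 2 ∷ 0 ∷ 7 ∷ 5 ∷ [])
    ∷ (2 ∷ 3 ∷ 4 ∷ 3 ∷ 4 ∷ 2 ∷ 4 ∷ 3 ∷ [])
    ∷ (4 ∷ 0 ∷ 2 ∷ 0 ∷ 5 ∷ 3 ∷ 5 ∷ 0 ∷ [])
    ∷ (4 ∷ 0 ∷ 2 ∷ 0 ∷ 2 ∷ 5 ∷ 7 ∷ 0 ∷ [])
    ∷ (6 ∷ 3 ∷ 7 ∷ 3 ∷ 1 ∷ 7 ∷ 1 ∷ 3 ∷ [])
    ∷ (7 ∷ 3 ∷ 6 ∷ 3 ∷ 6 ∷ 5 ∷ 6 ∷ 3 ∷ [])
    ∷ []

  horizontal₃ vertical₃ : Vec (Vec (Fin 9) 8) 5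
  horizontal₃ =
      (0 ∷ 5 ∷ 7 ∷ 1 ∷ 6 ∷ 5 ∷ 6 ∷ 1 ∷ [])
    ∷ (1 ∷ 8 ∷ 4 ∷ 3 ∷ 7 ∷ 2 ∷ 0 ∷ 2 ∷ [])
    ∷ (2 ∷ 6 ∷ 3 ∷ 6 ∷ 2 ∷ 6 ∷ 3 ∷ 0 ∷ [])
    ∷ (1 ∷ 7 ∷ 8 ∷ 0 ∷ 8 ∷ 7 ∷ 4 ∷ 7 ∷ [])
    ∷ (3 ∷ 6 ∷ 3 ∷ 6 ∷ 2 ∷ 3 ∷ 7 ∷ 6 ∷ [])
    ∷ []
  vertical₃ =
      (4 ∷ 1 ∷ 2 ∷ 5 ∷ 0 ∷ 8 ∷ 2 ∷ 5 ∷ [])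
    ∷ (3 ∷ 2 ∷ 6 ∷ 4 ∷ 4 ∷ 1 ∷ 3 ∷ 4 ∷ [])
    ∷ (3 ∷ 0 ∷ 5 ∷ 7 ∷ 3 ∷ 1 ∷ 4 ∷ 6 ∷ [])
    ∷ (8 ∷ 4 ∷ 1 ∷ 7 ∷ 1 ∷ 2 ∷ 5 ∷ 3 ∷ [])
    ∷ (4 ∷ 0 ∷ 2 ∷ 5 ∷ 5 ∷ 0 ∷ 1 ∷ 5 ∷ [])
    ∷ []

  horizontal₄ vertical₄ : Vec (Vec (Fin 10) 5) 5
  horizontal₄ =
      (0 ∷ 1 ∷ 1 ∷ 7 ∷ 2 ∷ [])
    ∷ (1 ∷ 5 ∷ 3 ∷ 0 ∷ 1 ∷ [])
    ∷ (2 ∷ 6 ∷ 7 ∷ 3 ∷ 4 ∷ [])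
    ∷ (1 ∷ 9 ∷ 8 ∷ 1 ∷ 0 ∷ [])
    ∷ (3 ∷ 6 ∷ 7 ∷ 9 ∷ 8 ∷ [])
    ∷ []
  vertical₄ =
      (4 ∷ 0 ∷ 5 ∷ 6 ∷ 5 ∷ [])
    ∷ (3 ∷ 2 ∷ 6 ∷ 8 ∷ 6 ∷ [])
    ∷ (8 ∷ 0 ∷ 4 ∷ 9 ∷ 7 ∷ [])
    ∷ (3 ∷ 5 ∷ 9 ∷ 8 ∷ 7 ∷ [])
    ∷ (7 ∷ 2 ∷ 4 ∷ 5 ∷ 4 ∷ [])
    ∷ []

  evenEven : ValidPatternColouring 7
  evenEven = record { valid = from-yes (ProductPattern.valid? evenPattern evenPattern (fromTable horizontal₁) (fromTable vertical₁)) }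

  oddEven : ValidPatternColouring 8
  oddEven = record { valid = from-yes (ProductPattern.valid? oddPattern evenPattern (fromTable horizontal₂) (fromTable vertical₂)) }

  anyEven : ValidPatternColouring 9
  anyEven = record { valid = from-yes (ProductPattern.valid? anyPattern evenPattern (fromTable horizontal₃) (fromTable vertical₃)) }

  anyAny : ValidPatternColouring 10
  anyAny = record { valid = from-yes (ProductPattern.valid? anyPattern anyPattern (fromTable horizontal₄) (fromTable vertical₄)) }

open Constructions using (evenHom; oddHom; anyHom; evenEven; oddEven; anyEven; anyAny)

theorem8 : (m n : ℕ) → 3 ≤ m → 3 ≤ n →
    ((2 ∣ m → 2 ∣ n → StarChromaticIndex≤ (CmCn m n) 7)
    × (3 < m → ¬ (2 ∣ m) → 2 ∣ n → StarChromaticIndex≤ (CmCn m n) 8)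
    × (m ≡ 3 → 2 ∣ n → StarChromaticIndex≤ (CmCn m n) 9)
    × (¬ (2 ∣ m) → ¬ (2 ∣ n) → StarChromaticIndex≤ (CmCn m n) 10))
theorem8 m n m≥3 n≥3 =
    (λ 2∣m 2∣n → transfer evenEven m≥3 n≥3 (evenHom m≥3 2∣m) (evenHom n≥3 2∣n))
  , (λ m>3 2∤m 2∣n → transfer oddEven m≥3 n≥3 (oddHom m>3 2∤m) (evenHom n≥3 2∣n))
  , (λ _ 2∣n → transfer anyEven m≥3 n≥3 (anyHom m≥3) (evenHom n≥3 2∣n))
  , (λ _ _ → transfer anyAny m≥3 n≥3 (anyHom m≥3) (anyHom n≥3))
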